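{- Let $K=\mathbb{Q}(\sqrt{ -d})$ with $d>0$ squarefree and $S$ a finite set of rational primes. If for every $\xi\in K\cap\mathcal{F}$ there exists $\alpha\in\mathcal{O}_S$ such that $|\xi-\alpha|<1/\mathrm{denom}_S(\alpha)$, then $K$ is $S$-norm-Euclidean.
   Context: Put $w=\sqrt{ -d}$ if $-d\equiv 2,3\pmod 4$ and $w=(1+\sqrt{ -d})/2$ if $-d\equiv 1\pmod 4$; $K\subseteq\mathbb{C}$ and $|\cdot|$ is the complex modulus. The norm is $N(x+y\sqrt{ -d})=x^2+dy^2$. $T$ is the set of positive integers all of whose prime factors lie in $S$ (so $1\in T$), and $\mathcal{O}_S=\{(a+bw)/c: a,b\in\mathbb{Z}, c\in T\}$. For $\alpha\in\mathcal{O}_S$, $\mathrm{denom}_S(\alpha)$ is the minimal $c$ over all representations $\alpha=(a+bw)/c$ with $a,b\in\mathbb{Z}$, $c\in T$. The fundamental domain is $\mathcal{F}=\{x+yw: x,y\in\mathbb{R},\ 0\le x,y\le 1\}\subseteq\mathbb{C}$. For nonzero $\xi\in K$, $N_S(\xi)$ is the positive rational obtained from $N(\xi)$ by deleting all primes of $S$ from the prime factorizations of its numerator and denominator; $N_S(0)=0$. $K$ is $S$-norm-Euclidean if for every $\xi\in K$ there exists $\gamma\in\mathcal{O}_S$ with $N_S(\xi-\gamma)<1$. -}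

module Defs where

open import Data.Nat as ℕ using (ℕ; zero; suc; _∸_; _%_; _/_)
open import Data.Nat.Divisibility using (_∣_)
open import Data.Nat.Primality using (Prime)
open import Data.Integer as ℤ using (ℤ; +_)
open import Data.Rational as ℚ using (ℚ; 0ℚ; 1ℚ; ½; fromℚᵘ; ↥_; ↧ₙ_)
open import Data.Rational.Unnormalised using (mkℚᵘ)
open import Data.List using (List; foldr)
open import Data.List.Membership.Propositional using (_∈_)
open import Data.Product using (_×_; _,_; ∃; ∃-syntax; proj₁; proj₂)
open import Relation.Binary.PropositionalEquality using (_≡_)

Squarefree : ℕ → Set
Squarefree d = ∀ n → n ℕ.* n ∣ d → n ≡ 1

-- Elements of K = ℚ(√-d) as pairs (x , y) meaning x + y√-d
K : Set
K = ℚ × ℚ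

ι : ℚ → K
ι x = x , 0ℚ

_+K_ : K → K → K
(a , b) +K (c , e) = (a ℚ.+ c) , (b ℚ.+ e)

_-K_ : K → K → K
(a , b) -K (c , e) = (a ℚ.- c) , (b ℚ.- e)

_·K_ : ℚ → K → K
q ·K (a , b) = (q ℚ.* a) , (q ℚ.* b)

N : ℕ → K → ℚ
N d (x , y) = x ℚ.* x ℚ.+ ((+ d) ℚ./ 1) ℚ.* (y ℚ.* y)

-- w = √-d if -d ≡ 2,3 (mod 4), i.e. d ≡ 2,1 (mod 4);
-- w = (1 + √-d)/2 if -d ≡ 1 (mod 4), i.e. d ≡ 3 (mod 4)
w : ℕ → K
w d with d % 4
... | 3 = ½ , ½
... | _ = 0ℚ , 1ℚ

ℤ→ℚ : ℤ → ℚ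
ℤ→ℚ a = a ℚ./ 1

ℕ→ℚ : ℕ → ℚ
ℕ→ℚ c = (+ c) ℚ./ 1

InT : List ℕ → ℕ → Set
InT S c = (1 ℕ.≤ c) × (∀ p → Prime p → p ∣ c → p ∈ S)

-- α = (a + b w)/c with c ∈ T  (written as c·α = a + b w, c ≥ 1)
Rep : ℕ → List ℕ → K → ℤ → ℤ → ℕ → Set
Rep d S α a b c = InT S c × (ℕ→ℚ c ·K α ≡ ι (ℤ→ℚ a) +K (ℤ→ℚ b ·K w d))

InOS : ℕ → List ℕ → K → Set
InOS d S α = ∃[ a ] ∃[ b ] ∃[ c ] Rep d S α a b c

IsDenom : ℕ → List ℕ → K → ℕ → Set
IsDenom d S α c =
  (∃[ a ] ∃[ b ] Rep d S α a b c) × (∀ a b c' → Rep d S α a b c' → c ℕ.≤ c')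

InF : ℕ → K → Set
InF d ξ = ∃[ x ] ∃[ y ]
  ((0ℚ ℚ.≤ x) × (x ℚ.≤ 1ℚ) × (0ℚ ℚ.≤ y) × (y ℚ.≤ 1ℚ) × (ξ ≡ ι x +K (y ·K w d)))

-- remove all factors p from n (fuel-bounded; fuel n suffices for n ≥ 1)
stripP : ℕ → ℕ → ℕ → ℕ
stripP zero p n = n
stripP (suc f) (suc (suc k)) n with n % suc (suc k)
... | zero = stripP f (suc (suc k)) (n / suc (suc k))
... | suc _ = n
stripP (suc f) _ n = n

stripS : List ℕ → ℕ → ℕ
stripS S n = foldr (λ p m → stripP m p m) n S

-- N_S(q) for the rational q = N(ξ): delete the primes of S from numerator
-- and denominator (N_S(0) = 0 automatically)
NS : List ℕ → ℚ → ℚ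
NS S q = fromℚᵘ (mkℚᵘ (+ stripS S ℤ.∣ ↥ q ∣) (stripS S (↧ₙ q) ∸ 1))

SNormEuclidean : ℕ → List ℕ → Set
SNormEuclidean d S = ∀ (ξ : K) → ∃[ γ ] (InOS d S γ × (NS S (N d (ξ -K γ)) ℚ.< 1ℚ))

{-# OPTIONS --safe #-}
module Submission where

-- Write ξ = (x + y w)/(t r) with t ∈ T and r prime to S.  Since gcd(t, r) = 1, partial fractions
-- give ξ = γ₀ + η with t γ₀ ∈ ℤ[w] (so γ₀ ∈ 𝒪_S) and η = (a′ + b′ w)/r, 0 ≤ a′, b′ < r, a point
-- of 𝓕.  The hypothesis yields α ∈ 𝒪_S, c α ∈ ℤ[w] with c ∈ T, and N(η − α) c² < 1; put
-- γ = γ₀ + α, so ξ − γ = η − α.  As c r (η − α) ∈ ℤ[w], writing N(η − α) = n/D in lowest terms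
-- gives n (c r)² = k D with k ∈ ℕ, and k < r² because n c² < D.  Deleting the primes of S kills
-- c and fixes r, so strip(n) r² = strip(k) strip(D) ≤ k strip(D) < r² strip(D): N_S(η − α) < 1.

open import Defs

module PrimeStripping where

  open import Data.Nat
  open import Data.Nat.Properties
  open import Data.Nat.DivMod using (m≡m%n+[m/n]*n; m/n<m)
  open import Data.Nat.Divisibility
  open import Data.Nat.Primality
  open import Data.Nat.Primality.Factorisation using (factorise)
  open import Data.Nat.ListAction using (product)
  open import Data.Nat.Coprimality using (Coprime)
  open import Data.List using (List; []; _∷_)
  open import Data.List.Membership.Propositional using (_∈_)
  open import Data.List.Relation.Unary.All using (All; []; _∷_; lookup)
  open import Data.List.Relation.Unary.Any using (here; there)
  open import Data.Product using (∃-syntax; _×_; _,_; proj₂)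
  open import Data.Sum using ([_,_]′)
  open import Function using (it)
  open import Relation.Nullary using (¬_; contradiction)
  open import Relation.Binary.PropositionalEquality

  -- stripS (p ∷ S) n reduces to strip p (stripS S n).
  strip : ℕ → ℕ → ℕ
  strip p n = stripP n p n

  stripP-spec : ∀ p .{{_ : NonTrivial p}} f n .{{_ : NonZero n}} → n ≤ f →
                ∃[ e ] n ≡ p ^ e * stripP f p n × ¬ p ∣ stripP f p n
  stripP-spec (2+ _) zero (suc _) ()
  stripP-spec p@(2+ _) (suc f) n n≤1+f with n % p in n%p≡
  ... | suc _ = 0 , sym (*-identityˡ n) , λ p∣n → 0≢1+n (trans (sym (n∣m⇒m%n≡0 n p p∣n)) n%p≡)
  ... | zero = step (stripP-spec p f (n / p) {{n/p≢0}} n/p≤f)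
    where
    n≡[n/p]*p : n ≡ n / p * p
    n≡[n/p]*p = trans (m≡m%n+[m/n]*n n p) (cong (_+ n / p * p) n%p≡)
    n/p≢0 : NonZero (n / p)
    n/p≢0 = m*n≢0⇒m≢0 (n / p) {{subst NonZero n≡[n/p]*p it}}
    n/p≤f : n / p ≤ f
    n/p≤f = ≤-pred (≤-trans (m/n<m n p (s≤s (s≤s z≤n))) n≤1+f)
    step : ∃[ e ] n / p ≡ p ^ e * stripP f p (n / p) × ¬ p ∣ stripP f p (n / p) →
           ∃[ e ] n ≡ p ^ e * stripP f p (n / p) × ¬ p ∣ stripP f p (n / p)
    step (e , n/p≡ , p∤) = suc e , n≡ , p∤
      where
      open ≡-Reasoning
      n≡ : n ≡ p ^ suc e * stripP f p (n / p)
      n≡ = begin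
        n                              ≡⟨ n≡[n/p]*p ⟩
        n / p * p                      ≡⟨ cong (_* p) n/p≡ ⟩
        p ^ e * stripP f p (n / p) * p ≡⟨ *-comm (p ^ e * stripP f p (n / p)) p ⟩
        p * (p ^ e * stripP f p (n / p)) ≡⟨ *-assoc p (p ^ e) _ ⟨
        p * p ^ e * stripP f p (n / p) ∎

  p-free-part-unique : ∀ p .{{_ : NonZero p}} i j a b → p ^ i * a ≡ p ^ j * b →
                       ¬ p ∣ a → ¬ p ∣ b → a ≡ b
  p-free-part-unique p zero    zero    a b eq _   _   =
    trans (sym (*-identityˡ a)) (trans eq (*-identityˡ b))
  p-free-part-unique p zero    (suc j) a b eq p∤a _   =
    contradiction (subst (p ∣_) (sym a≡) (m∣m*n (p ^ j * b))) p∤a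
    where
    a≡ : a ≡ p * (p ^ j * b)
    a≡ = trans (sym (*-identityˡ a)) (trans eq (*-assoc p (p ^ j) b))
  p-free-part-unique p (suc i) zero    a b eq p∤a p∤b =
    sym (p-free-part-unique p zero (suc i) b a (sym eq) p∤b p∤a)
  p-free-part-unique p (suc i) (suc j) a b eq p∤a p∤b =
    p-free-part-unique p i j a b (*-cancelˡ-≡ _ _ p eq′) p∤a p∤b
    where
    eq′ : p * (p ^ i * a) ≡ p * (p ^ j * b)
    eq′ = trans (sym (*-assoc p (p ^ i) a)) (trans eq (*-assoc p (p ^ j) b))

  strip-spec : ∀ p .{{_ : NonTrivial p}} n .{{_ : NonZero n}} →
               ∃[ e ] n ≡ p ^ e * strip p n × ¬ p ∣ strip p n
  strip-spec p n = stripP-spec p n n ≤-refl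

  strip-fix : ∀ p .{{_ : NonTrivial p}} n .{{_ : NonZero n}} → ¬ p ∣ n → strip p n ≡ n
  strip-fix p n p∤n with strip-spec p n
  ... | e , n≡ , p∤ = p-free-part-unique p e 0 _ n (trans (sym n≡) (sym (*-identityˡ n))) p∤ p∤n
    where instance _ = nonTrivial⇒nonZero p

  strip-∣ : ∀ p .{{_ : NonTrivial p}} n → strip p n ∣ n
  strip-∣ p zero = 0 ∣0
  strip-∣ p n@(suc _) with strip-spec p n
  ... | e , n≡ , _ = divides (p ^ e) n≡

  strip-* : ∀ {p} → Prime p → ∀ a b → strip p (a * b) ≡ strip p a * strip p b
  strip-* pp zero b = refl
  strip-* {p} pp a@(suc _) zero rewrite *-zeroʳ a = sym (*-zeroʳ (strip p a))
  strip-* {p} pp@(prime _) a@(suc _) b@(suc _)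
    with strip-spec p a | strip-spec p b | strip-spec p (a * b)
  ... | i , a≡ , p∤a | j , b≡ , p∤b | l , ab≡ , p∤ab =
    p-free-part-unique p l (i + j) _ _ eq p∤ab (λ p∣ → [ p∤a , p∤b ]′ (euclidsLemma _ _ pp p∣))
    where
    instance _ = prime⇒nonZero pp
    eq : p ^ l * strip p (a * b) ≡ p ^ (i + j) * (strip p a * strip p b)
    eq = begin
      p ^ l * strip p (a * b)                       ≡⟨ ab≡ ⟨
      a * b                                         ≡⟨ cong₂ _*_ a≡ b≡ ⟩
      (p ^ i * strip p a) * (p ^ j * strip p b)     ≡⟨ [m*n]*[o*p]≡[m*o]*[n*p] (p ^ i) _ (p ^ j) _ ⟩
      (p ^ i * p ^ j) * (strip p a * strip p b)     ≡⟨ cong (_* _) (^-distribˡ-+-* p i j) ⟨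
      p ^ (i + j) * (strip p a * strip p b)         ∎
      where open ≡-Reasoning

  PrimeTo : List ℕ → ℕ → Set
  PrimeTo S r = ∀ p → p ∈ S → ¬ p ∣ r

  prime-divisor : ∀ n → 1 < n → ∃[ p ] Prime p × p ∣ n
  prime-divisor n@(suc _) 1<n with factorise n
  ... | record { factors = []     ; isFactorisation = n≡1 } = contradiction n≡1 (>⇒≢ 1<n)
  ... | record { factors = p ∷ ps ; isFactorisation = n≡ ; factorsPrime = pp ∷ _ } =
    p , pp , divides (product ps) (trans n≡ (*-comm p (product ps)))

  InT-1 : ∀ S → InT S 1
  InT-1 S = ≤-refl , λ p pp p∣1 → contradiction (∣1⇒≡1 p∣1) (nonTrivial⇒≢1 {{prime⇒nonTrivial pp}})

  InT-* : ∀ {S m n} → InT S m → InT S n → InT S (m * n)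
  InT-* {m = m} {n} (1≤m , m∈T) (1≤n , n∈T) =
    *-mono-≤ 1≤m 1≤n , λ p pp p∣mn → [ m∈T p pp , n∈T p pp ]′ (euclidsLemma m n pp p∣mn)

  InT-prime : ∀ {S p} → Prime p → p ∈ S → InT S p
  InT-prime {p = p} pp p∈S = >-nonZero⁻¹ p {{prime⇒nonZero pp}} , λ q qp q∣p →
    [ (λ q≡1 → contradiction q≡1 (nonTrivial⇒≢1 {{prime⇒nonTrivial qp}}))
    , (λ q≡p → subst (_∈ _) (sym q≡p) p∈S) ]′ (prime⇒irreducible pp q∣p)

  InT-^ : ∀ {S p} → InT S p → ∀ e → InT S (p ^ e)
  InT-^ {S} p∈T zero    = InT-1 S
  InT-^     p∈T (suc e) = InT-* p∈T (InT-^ p∈T e)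

  InT⇒coprime : ∀ {S t r} → InT S t → PrimeTo S r → Coprime t r
  InT⇒coprime (1≤t , _)   _       {0}      (0∣t , _)   = contradiction (0∣⇒≡0 0∣t) (>⇒≢ 1≤t)
  InT⇒coprime _           _       {1}      _           = refl
  InT⇒coprime (_ , t∈T)   r-prime {d@(2+ _)} (d∣t , d∣r) with prime-divisor d (s≤s (s≤s z≤n))
  ... | p , pp , p∣d = contradiction (∣-trans p∣d d∣r) (r-prime p (t∈T p pp (∣-trans p∣d d∣t)))

  primeTo-* : ∀ {S m n} → All Prime S → PrimeTo S m → PrimeTo S n → PrimeTo S (m * n)
  primeTo-* {m = m} {n} ps m-prime n-prime p p∈S p∣mn =
    [ m-prime p p∈S , n-prime p p∈S ]′ (euclidsLemma m n (lookup ps p∈S) p∣mn)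

  InT-∷ : ∀ {S p t} → InT S t → InT (p ∷ S) t
  InT-∷ (1≤t , t∈T) = 1≤t , λ q qp q∣t → there (t∈T q qp q∣t)

  stripS-0 : ∀ S → stripS S 0 ≡ 0
  stripS-0 []      = refl
  stripS-0 (p ∷ S) rewrite stripS-0 S = refl

  stripS-* : ∀ {S} → All Prime S → ∀ a b → stripS S (a * b) ≡ stripS S a * stripS S b
  stripS-* []               a b = refl
  stripS-* {p ∷ S} (pp ∷ ps) a b rewrite stripS-* ps a b = strip-* pp (stripS S a) (stripS S b)

  stripS-∣ : ∀ {S} → All Prime S → ∀ n → stripS S n ∣ n
  stripS-∣ []                        n = ∣-refl
  stripS-∣ {p ∷ S} (prime _ ∷ ps) n = ∣-trans (strip-∣ p (stripS S n)) (stripS-∣ ps n)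

  stripS-≢0 : ∀ {S} → All Prime S → ∀ n .{{_ : NonZero n}} → NonZero (stripS S n)
  stripS-≢0 ps n = ≢-nonZero λ s≡0 → ≢-nonZero⁻¹ n (0∣⇒≡0 (subst (_∣ n) s≡0 (stripS-∣ ps n)))

  stripS-≤ : ∀ {S} → All Prime S → ∀ n → stripS S n ≤ n
  stripS-≤ {S} ps zero      = ≤-reflexive (stripS-0 S)
  stripS-≤     ps n@(suc _) = ∣⇒≤ (stripS-∣ ps n)

  stripS-primeTo : ∀ {S} → All Prime S → ∀ n .{{_ : NonZero n}} → PrimeTo S (stripS S n)
  stripS-primeTo {p ∷ S} (prime _ ∷ ps) n .p (here refl) =
    proj₂ (proj₂ (strip-spec p (stripS S n) {{stripS-≢0 ps n}}))
  stripS-primeTo {p ∷ S} (prime _ ∷ ps) n q  (there q∈S) q∣ =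
    stripS-primeTo ps n q q∈S (∣-trans q∣ (strip-∣ p (stripS S n)))

  stripS-fix : ∀ {S} → All Prime S → ∀ r .{{_ : NonZero r}} → PrimeTo S r → stripS S r ≡ r
  stripS-fix []                     r _       = refl
  stripS-fix {p ∷ S} (prime _ ∷ ps) r r-prime
    rewrite stripS-fix ps r (λ q q∈S → r-prime q (there q∈S)) = strip-fix p r (r-prime p (here refl))

  stripS-InT : ∀ {S} → All Prime S → ∀ {c} → InT S c → stripS S c ≡ 1
  stripS-InT ps {c} c∈T@(1≤c , _) =
    InT⇒coprime c∈T (stripS-primeTo ps c {{>-nonZero 1≤c}}) (stripS-∣ ps c , ∣-refl)

  stripS-cofactor : ∀ {S} → All Prime S → ∀ n .{{_ : NonZero n}} → ∃[ t ] InT S t × n ≡ t * stripS S n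
  stripS-cofactor []                     n = 1 , InT-1 [] , sym (*-identityˡ n)
  stripS-cofactor {p ∷ S} (pp@(prime _) ∷ ps) n
    with stripS-cofactor ps n | strip-spec p (stripS S n) {{stripS-≢0 ps n}}
  ... | t , t∈T , n≡ | e , s≡ , _ =
    t * p ^ e , InT-* (InT-∷ t∈T) (InT-^ (InT-prime pp (here refl)) e) ,
    trans n≡ (trans (cong (t *_) s≡) (sym (*-assoc t (p ^ e) _)))

  stripS-< : ∀ {S} → All Prime S → ∀ {u v} → InT S u → PrimeTo S v → .{{_ : NonZero v}} →
             ∀ n k D → n * (u * v) ≡ k * D → n * u < D → stripS S n < stripS S D
  stripS-< {S} ps {u} {v} u∈T v-prime n k D nuv≡kD nu<D =
    *-cancelʳ-< v (stripS S n) (stripS S D) (begin-strict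
      stripS S n * v           ≡⟨ stripped ⟩
      stripS S k * stripS S D  ≤⟨ *-monoˡ-≤ (stripS S D) (stripS-≤ ps k) ⟩
      k * stripS S D           <⟨ *-monoˡ-< (stripS S D) {{stripS-≢0 ps D}} k<v ⟩
      v * stripS S D           ≡⟨ *-comm v (stripS S D) ⟩
      stripS S D * v           ∎)
    where
    open ≤-Reasoning
    instance
      D≢0 : NonZero D
      D≢0 = ≢-nonZero (m<n⇒n≢0 nu<D)
    k<v : k < v
    k<v = *-cancelʳ-< D k v (begin-strict
      k * D        ≡⟨ nuv≡kD ⟨
      n * (u * v)  ≡⟨ *-assoc n u v ⟨
      n * u * v    <⟨ *-monoˡ-< v nu<D ⟩
      D * v        ≡⟨ *-comm D v ⟩
      v * D        ∎)
    stripped : stripS S n * v ≡ stripS S k * stripS S D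
    stripped = begin-equality
      stripS S n * v                           ≡⟨ cong (stripS S n *_) (*-identityˡ v) ⟨
      stripS S n * (1 * v)                     ≡⟨ cong (stripS S n *_) (cong₂ _*_ (stripS-InT ps u∈T) (stripS-fix ps v v-prime)) ⟨
      stripS S n * (stripS S u * stripS S v)   ≡⟨ cong (stripS S n *_) (stripS-* ps u v) ⟨
      stripS S n * stripS S (u * v)            ≡⟨ stripS-* ps n (u * v) ⟨
      stripS S (n * (u * v))                   ≡⟨ cong (stripS S) nuv≡kD ⟩
      stripS S (k * D)                         ≡⟨ stripS-* ps k D ⟩
      stripS S k * stripS S D                  ∎

module RationalArithmetic where

  open PrimeStripping
  open import Data.Nat as ℕ using (ℕ; suc; NonZero)
  import Data.Nat.Properties as ℕ
  open import Data.Integer as ℤ using (ℤ; +_; -[1+_])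
  import Data.Integer.Properties as ℤ
  open import Data.List.Relation.Unary.All using (All)
  open import Data.Nat.Primality using (Prime)
  open import Data.Rational as ℚ using (ℚ; mkℚ; _+_; _*_; _-_; _<_; _≤_; 0ℚ; 1ℚ; ↥_; ↧_; ↧ₙ_; toℚᵘ; _/_)
  open import Data.Rational.Properties as ℚ
    using (toℚᵘ-injective; toℚᵘ-fromℚᵘ; toℚᵘ-homo-+; toℚᵘ-homo-*; toℚᵘ-homo‿-; toℚᵘ-cong; toℚᵘ-mono-<; toℚᵘ-cancel-<; toℚᵘ-cancel-≤)
  open import Data.Rational.Unnormalised as ℚᵘ using (mkℚᵘ; *≡*; *<*; *≤*)
  import Data.Rational.Unnormalised.Properties as ℚᵘ
  open import Level using (0ℓ)
  open import Relation.Nullary.Decidable.Core using (dec⇒maybe)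
  open import Relation.Binary.PropositionalEquality
  import Tactic.RingSolver.Core.AlmostCommutativeRing as ACR
  open import Tactic.RingSolver using (solve-∀)

  ℚ-ring : ACR.AlmostCommutativeRing 0ℓ 0ℓ
  ℚ-ring = ACR.fromCommutativeRing ℚ.+-*-commutativeRing (λ x → dec⇒maybe (0ℚ ℚ.≟ x))

  toℚᵘ-ℤ→ℚ : ∀ i → toℚᵘ (ℤ→ℚ i) ℚᵘ.≃ mkℚᵘ i 0
  toℚᵘ-ℤ→ℚ i = toℚᵘ-fromℚᵘ (mkℚᵘ i 0)

  ℤ→ℚ-+ : ∀ i j → ℤ→ℚ (i ℤ.+ j) ≡ ℤ→ℚ i + ℤ→ℚ j
  ℤ→ℚ-+ i j = toℚᵘ-injective (ℚᵘ.≃-trans (toℚᵘ-ℤ→ℚ (i ℤ.+ j)) (ℚᵘ.≃-sym (ℚᵘ.≃-trans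
    (toℚᵘ-homo-+ (ℤ→ℚ i) (ℤ→ℚ j)) (ℚᵘ.≃-trans (ℚᵘ.+-cong (toℚᵘ-ℤ→ℚ i) (toℚᵘ-ℤ→ℚ j))
    (*≡* (cong₂ ℤ._*_ (cong₂ ℤ._+_ (ℤ.*-identityʳ i) (ℤ.*-identityʳ j)) refl))))))

  ℤ→ℚ-* : ∀ i j → ℤ→ℚ (i ℤ.* j) ≡ ℤ→ℚ i * ℤ→ℚ j
  ℤ→ℚ-* i j = toℚᵘ-injective (ℚᵘ.≃-trans (toℚᵘ-ℤ→ℚ (i ℤ.* j)) (ℚᵘ.≃-sym (ℚᵘ.≃-trans
    (toℚᵘ-homo-* (ℤ→ℚ i) (ℤ→ℚ j)) (ℚᵘ.≃-trans (ℚᵘ.*-cong (toℚᵘ-ℤ→ℚ i) (toℚᵘ-ℤ→ℚ j)) (*≡* refl)))))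

  ℤ→ℚ-neg : ∀ i → ℤ→ℚ (ℤ.- i) ≡ ℚ.- ℤ→ℚ i
  ℤ→ℚ-neg i = toℚᵘ-injective (ℚᵘ.≃-trans (toℚᵘ-ℤ→ℚ (ℤ.- i)) (ℚᵘ.≃-sym (ℚᵘ.≃-trans
    (toℚᵘ-homo‿- (ℤ→ℚ i)) (ℚᵘ.≃-trans (ℚᵘ.-‿cong (toℚᵘ-ℤ→ℚ i)) (*≡* refl)))))

  ℤ→ℚ-- : ∀ i j → ℤ→ℚ (i ℤ.- j) ≡ ℤ→ℚ i - ℤ→ℚ j
  ℤ→ℚ-- i j = trans (ℤ→ℚ-+ i (ℤ.- j)) (cong (ℤ→ℚ i ℚ.+_) (ℤ→ℚ-neg j))

  ℕ→ℚ-* : ∀ m n → ℕ→ℚ (m ℕ.* n) ≡ ℕ→ℚ m * ℕ→ℚ n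
  ℕ→ℚ-* m n = trans (cong ℤ→ℚ (ℤ.pos-* m n)) (ℤ→ℚ-* (+ m) (+ n))

  ℕ→ℚ-+ : ∀ m n → ℕ→ℚ (m ℕ.+ n) ≡ ℕ→ℚ m + ℕ→ℚ n
  ℕ→ℚ-+ m n = ℤ→ℚ-+ (+ m) (+ n)

  n*[i/n]≡i : ∀ i n .{{_ : NonZero n}} → ℕ→ℚ n * (i / n) ≡ ℤ→ℚ i
  n*[i/n]≡i i n@(suc n-1) = toℚᵘ-injective (begin
    toℚᵘ (ℕ→ℚ n * (i / n))              ≈⟨ toℚᵘ-homo-* (ℕ→ℚ n) (i / n) ⟩
    toℚᵘ (ℕ→ℚ n) ℚᵘ.* toℚᵘ (i / n)     ≈⟨ ℚᵘ.*-cong (toℚᵘ-ℤ→ℚ (+ n)) (toℚᵘ-fromℚᵘ (mkℚᵘ i n-1)) ⟩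
    mkℚᵘ (+ n) 0 ℚᵘ.* mkℚᵘ i n-1        ≈⟨ *≡* cross ⟩
    mkℚᵘ i 0                            ≈⟨ toℚᵘ-ℤ→ℚ i ⟨
    toℚᵘ (ℤ→ℚ i)                        ∎)
    where
    open ℚᵘ.≃-Reasoning
    cross : + n ℤ.* i ℤ.* + 1 ≡ i ℤ.* + (1 ℕ.* n)
    cross = trans (ℤ.*-identityʳ (+ n ℤ.* i))
      (trans (ℤ.*-comm (+ n) i) (cong (λ m → i ℤ.* + m) (sym (ℕ.*-identityˡ n))))

  *-cancelˡ-ℕ→ℚ : ∀ n .{{_ : NonZero n}} {p q} → ℕ→ℚ n * p ≡ ℕ→ℚ n * q → p ≡ q
  *-cancelˡ-ℕ→ℚ n {p} {q} np≡nq = begin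
    p                        ≡⟨ ℚ.*-identityˡ p ⟨
    1ℚ * p                   ≡⟨ cong (_* p) n*n⁻¹≡1 ⟨
    (ℕ→ℚ n * n⁻¹) * p        ≡⟨ reassoc (ℕ→ℚ n) n⁻¹ p ⟩
    n⁻¹ * (ℕ→ℚ n * p)        ≡⟨ cong (n⁻¹ *_) np≡nq ⟩
    n⁻¹ * (ℕ→ℚ n * q)        ≡⟨ reassoc (ℕ→ℚ n) n⁻¹ q ⟨
    (ℕ→ℚ n * n⁻¹) * q        ≡⟨ cong (_* q) n*n⁻¹≡1 ⟩
    1ℚ * q                   ≡⟨ ℚ.*-identityˡ q ⟩
    q                        ∎
    where
    open ≡-Reasoning
    n⁻¹ = + 1 / n
    n*n⁻¹≡1 : ℕ→ℚ n * n⁻¹ ≡ 1ℚ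
    n*n⁻¹≡1 = n*[i/n]≡i (+ 1) n
    reassoc : ∀ x y z → (x * y) * z ≡ y * (x * z)
    reassoc = solve-∀ ℚ-ring

  0≤a/n : ∀ a n .{{_ : NonZero n}} → 0ℚ ≤ + a / n
  0≤a/n a n@(suc _) = ℚ.nonNegative⁻¹ (+ a / n) {{ℚ.normalize-nonNeg a n}}

  a<n⇒a/n≤1 : ∀ {a n} .{{_ : NonZero n}} → a ℕ.< n → + a / n ≤ 1ℚ
  a<n⇒a/n≤1 {a} {n@(suc n-1)} a<n = toℚᵘ-cancel-≤ (ℚᵘ.≤-respˡ-≃ (ℚᵘ.≃-sym (toℚᵘ-fromℚᵘ (mkℚᵘ (+ a) n-1)))
    (*≤* (subst₂ ℤ._≤_ (sym (ℤ.*-identityʳ (+ a))) (sym (ℤ.*-identityˡ (+ n))) (ℤ.+≤+ (ℕ.<⇒≤ a<n)))))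

  a<n⇒a/n<1 : ∀ {a n} .{{_ : NonZero n}} → a ℕ.< n → + a / n < 1ℚ
  a<n⇒a/n<1 {a} {n@(suc n-1)} a<n = toℚᵘ-cancel-< (ℚᵘ.<-respˡ-≃ (ℚᵘ.≃-sym (toℚᵘ-fromℚᵘ (mkℚᵘ (+ a) n-1)))
    (*<* (subst₂ ℤ._<_ (sym (ℤ.*-identityʳ (+ a))) (sym (ℤ.*-identityˡ (+ n))) (ℤ.+<+ a<n))))

  ↥*≡*↧ : ∀ q m k → q * ℕ→ℚ m ≡ ℤ→ℚ k → ↥ q ℤ.* + m ≡ k ℤ.* ↧ q
  ↥*≡*↧ q@(mkℚ n d-1 _) m k qm≡k = cross-multiply (begin
    mkℚᵘ n d-1 ℚᵘ.* mkℚᵘ (+ m) 0     ≈⟨ ℚᵘ.*-congˡ {toℚᵘ q} (toℚᵘ-ℤ→ℚ (+ m)) ⟨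
    toℚᵘ q ℚᵘ.* toℚᵘ (ℕ→ℚ m)         ≈⟨ toℚᵘ-homo-* q (ℕ→ℚ m) ⟨
    toℚᵘ (q * ℕ→ℚ m)                ≈⟨ toℚᵘ-cong qm≡k ⟩
    toℚᵘ (ℤ→ℚ k)                    ≈⟨ toℚᵘ-ℤ→ℚ k ⟩
    mkℚᵘ k 0                        ∎)
    where
    open ℚᵘ.≃-Reasoning
    cross-multiply : mkℚᵘ n d-1 ℚᵘ.* mkℚᵘ (+ m) 0 ℚᵘ.≃ mkℚᵘ k 0 → n ℤ.* + m ≡ k ℤ.* + suc d-1
    cross-multiply (*≡* eq) =
      trans (sym (ℤ.*-identityʳ (n ℤ.* + m))) (trans eq (cong (λ d → k ℤ.* + d) (ℕ.*-identityʳ (suc d-1))))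

  ↥*<↧ : ∀ q m → q * ℕ→ℚ m < 1ℚ → ↥ q ℤ.* + m ℤ.< ↧ q
  ↥*<↧ q@(mkℚ n d-1 _) m qm<1 = cross-multiply (begin-strict
    mkℚᵘ n d-1 ℚᵘ.* mkℚᵘ (+ m) 0     ≃⟨ ℚᵘ.*-congˡ {toℚᵘ q} (toℚᵘ-ℤ→ℚ (+ m)) ⟨
    toℚᵘ q ℚᵘ.* toℚᵘ (ℕ→ℚ m)         ≃⟨ toℚᵘ-homo-* q (ℕ→ℚ m) ⟨
    toℚᵘ (q * ℕ→ℚ m)                <⟨ toℚᵘ-mono-< qm<1 ⟩
    toℚᵘ 1ℚ                         ∎)
    where
    open ℚᵘ.≤-Reasoning
    cross-multiply : mkℚᵘ n d-1 ℚᵘ.* mkℚᵘ (+ m) 0 ℚᵘ.< ℚᵘ.1ℚᵘ → n ℤ.* + m ℤ.< + suc d-1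
    cross-multiply (*<* lt) = subst₂ ℤ._<_ (ℤ.*-identityʳ (n ℤ.* + m))
      (trans (ℤ.*-identityˡ _) (cong +_ (ℕ.*-identityʳ (suc d-1)))) lt

  stripped<⇒NS<1 : ∀ S q → stripS S ℤ.∣ ↥ q ∣ ℕ.< stripS S (↧ₙ q) → NS S q < 1ℚ
  stripped<⇒NS<1 S q num<den = a<n⇒a/n<1 (subst (stripS S ℤ.∣ ↥ q ∣ ℕ.<_) (sym (ℕ.suc-pred _ {{den≢0}})) num<den)
    where den≢0 = ℕ.≢-nonZero (ℕ.m<n⇒n≢0 num<den)

  integral-multiple⇒NS<1 : ∀ {S} → All Prime S → ∀ {u v} → InT S u → PrimeTo S v → .{{_ : NonZero v}} →
          ∀ q k → 0ℚ ≤ q → q * ℕ→ℚ (u ℕ.* v) ≡ ℤ→ℚ k → q * ℕ→ℚ u < 1ℚ → NS S q < 1ℚ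
  integral-multiple⇒NS<1 ps u∈T v-prime (mkℚ -[1+ _ ] _ _) _ (ℚ.*≤* ()) _ _
  integral-multiple⇒NS<1 ps {u} {v} u∈T v-prime q@(mkℚ (+ n) d-1 _) k@(-[1+ _ ]) _ q*uv≡k _
    with () ← trans (ℤ.pos-* n (u ℕ.* v)) (↥*≡*↧ q (u ℕ.* v) k q*uv≡k)
  integral-multiple⇒NS<1 {S} ps {u} {v} u∈T v-prime q@(mkℚ (+ n) d-1 _) (+ k) _ q*uv≡k q*u<1 =
    stripped<⇒NS<1 S q (stripS-< ps u∈T v-prime n k (suc d-1) n*uv≡k*d n*u<d)
    where
    n*uv≡k*d : n ℕ.* (u ℕ.* v) ≡ k ℕ.* suc d-1
    n*uv≡k*d = ℤ.+-injective (trans (ℤ.pos-* n (u ℕ.* v))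
      (trans (↥*≡*↧ q (u ℕ.* v) (+ k) q*uv≡k) (sym (ℤ.pos-* k (suc d-1)))))
    n*u<d : n ℕ.* u ℕ.< suc d-1
    n*u<d = ℤ.drop‿+<+ (subst (ℤ._< + suc d-1) (sym (ℤ.pos-* n u)) (↥*<↧ q u q*u<1))

module QuadraticField where

  open PrimeStripping
  open RationalArithmetic
  open import Data.Nat as ℕ using (ℕ; suc)
  import Data.Nat.DivMod as ℕ
  open import Data.Integer as ℤ using (+_; -[1+_])
  open import Data.Rational as ℚ using (ℚ; mkℚ; _+_; _*_; _-_; _≤_; 0ℚ; 1ℚ; ½)
  import Data.Rational.Properties as ℚ
  open import Data.Product using (∃-syntax; _×_; _,_; proj₁)
  open import Data.Sum using (_⊎_; inj₁; inj₂)
  open import Relation.Binary.PropositionalEquality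
  open import Tactic.RingSolver using (solve-∀)

  fromCoords : ℕ → ℚ → ℚ → K
  fromCoords d x y = ι x +K (y ·K w d)

  InOK : ℕ → K → Set
  InOK d z = ∃[ a ] ∃[ b ] z ≡ fromCoords d (ℤ→ℚ a) (ℤ→ℚ b)

  fromCoords-+ : ∀ d x y x′ y′ → fromCoords d x y +K fromCoords d x′ y′ ≡ fromCoords d (x + x′) (y + y′)
  fromCoords-+ d x y x′ y′ with w d
  ... | w₁ , w₂ = cong₂ _,_ (first x y x′ y′ w₁) (second y y′ w₂)
    where
    first : ∀ x y x′ y′ w₁ → (x + y * w₁) + (x′ + y′ * w₁) ≡ (x + x′) + (y + y′) * w₁
    first = solve-∀ ℚ-ring
    second : ∀ y y′ w₂ → (0ℚ + y * w₂) + (0ℚ + y′ * w₂) ≡ 0ℚ + (y + y′) * w₂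
    second = solve-∀ ℚ-ring

  fromCoords-- : ∀ d x y x′ y′ → fromCoords d x y -K fromCoords d x′ y′ ≡ fromCoords d (x - x′) (y - y′)
  fromCoords-- d x y x′ y′ with w d
  ... | w₁ , w₂ = cong₂ _,_ (first x y x′ y′ w₁) (second y y′ w₂)
    where
    first : ∀ x y x′ y′ w₁ → (x + y * w₁) - (x′ + y′ * w₁) ≡ (x - x′) + (y - y′) * w₁
    first = solve-∀ ℚ-ring
    second : ∀ y y′ w₂ → (0ℚ + y * w₂) - (0ℚ + y′ * w₂) ≡ 0ℚ + (y - y′) * w₂
    second = solve-∀ ℚ-ring

  ·K-fromCoords : ∀ d q x y → q ·K fromCoords d x y ≡ fromCoords d (q * x) (q * y)
  ·K-fromCoords d q x y with w d
  ... | w₁ , w₂ = cong₂ _,_ (first q x y w₁) (second q y w₂)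
    where
    first : ∀ q x y w₁ → q * (x + y * w₁) ≡ q * x + (q * y) * w₁
    first = solve-∀ ℚ-ring
    second : ∀ q y w₂ → q * (0ℚ + y * w₂) ≡ 0ℚ + (q * y) * w₂
    second = solve-∀ ℚ-ring

  ·K-fromCoords-- : ∀ d q x y x′ y′ →
    q ·K (fromCoords d x y -K fromCoords d x′ y′) ≡ fromCoords d (q * (x - x′)) (q * (y - y′))
  ·K-fromCoords-- d q x y x′ y′ =
    trans (cong (q ·K_) (fromCoords-- d x y x′ y′)) (·K-fromCoords d q (x - x′) (y - y′))

  *-·K-+K : ∀ p q z z′ → (p * q) ·K (z +K z′) ≡ (q ·K (p ·K z)) +K (p ·K (q ·K z′))
  *-·K-+K p q (x , y) (x′ , y′) = cong₂ _,_ (law p q x x′) (law p q y y′)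
    where
    law : ∀ p q x x′ → (p * q) * (x + x′) ≡ q * (p * x) + p * (q * x′)
    law = solve-∀ ℚ-ring

  *-·K--K : ∀ p q z z′ → (p * q) ·K (z -K z′) ≡ (q ·K (p ·K z)) -K (p ·K (q ·K z′))
  *-·K--K p q (x , y) (x′ , y′) = cong₂ _,_ (law p q x x′) (law p q y y′)
    where
    law : ∀ p q x x′ → (p * q) * (x - x′) ≡ q * (p * x) - p * (q * x′)
    law = solve-∀ ℚ-ring

  -K-+K-cancel : ∀ z u v → z -K ((z -K u) +K v) ≡ u -K v
  -K-+K-cancel (x , y) (a , b) (c , e) = cong₂ _,_ (law x a c) (law y b e)
    where
    law : ∀ x a c → x - ((x - a) + c) ≡ a - c
    law = solve-∀ ℚ-ring

  N-·K : ∀ d q z → N d (q ·K z) ≡ (q * q) * N d z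
  N-·K d q (x , y) = law q x y (ℕ→ℚ d)
    where
    law : ∀ q x y D → (q * x) * (q * x) + D * ((q * y) * (q * y)) ≡ (q * q) * (x * x + D * (y * y))
    law = solve-∀ ℚ-ring

  square-nonNeg : ∀ x → ℚ.NonNegative (x * x)
  square-nonNeg x@(mkℚ (+ _)    _ _) = ℚ.nonNeg*nonNeg⇒nonNeg x x
  square-nonNeg x@(mkℚ -[1+ _ ] _ _) = ℚ.nonPos*nonPos⇒nonPos x x

  N-nonNeg : ∀ d z → 0ℚ ≤ N d z
  N-nonNeg d (x , y) = ℚ.nonNegative⁻¹ _ {{ℚ.nonNeg+nonNeg⇒nonNeg (x * x) {{square-nonNeg x}} _
    {{ℚ.nonNeg*nonNeg⇒nonNeg (ℕ→ℚ d) {{ℚ.normalize-nonNeg d 1}} (y * y) {{square-nonNeg y}}}}}}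

  N-fromCoords : ∀ d x y → N d (fromCoords d x y) ≡
                 x * x + (proj₁ (w d) + proj₁ (w d)) * (x * y) + N d (w d) * (y * y)
  N-fromCoords d x y with w d
  ... | w₁ , w₂ = law x y w₁ w₂ (ℕ→ℚ d)
    where
    law : ∀ x y w₁ w₂ D → (x + y * w₁) * (x + y * w₁) + D * ((0ℚ + y * w₂) * (0ℚ + y * w₂)) ≡
          x * x + (w₁ + w₁) * (x * y) + (w₁ * w₁ + D * (w₂ * w₂)) * (y * y)
    law = solve-∀ ℚ-ring

  w-cases : ∀ d → w d ≡ (0ℚ , 1ℚ) ⊎ (w d ≡ (½ , ½) × ∃[ e ] d ≡ 3 ℕ.+ e ℕ.* 4)
  w-cases d with d ℕ.% 4 in d%4≡
  ... | 0 = inj₁ refl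
  ... | 1 = inj₁ refl
  ... | 2 = inj₁ refl
  ... | 3 = inj₂ (refl , d ℕ./ 4 , trans (ℕ.m≡m%n+[m/n]*n d 4) (cong (ℕ._+ d ℕ./ 4 ℕ.* 4) d%4≡))
  ... | suc (suc (suc (suc _))) = inj₁ refl

  w-integral : ∀ d → ∃[ s ] ∃[ n ] proj₁ (w d) + proj₁ (w d) ≡ ℤ→ℚ s × N d (w d) ≡ ℤ→ℚ n
  w-integral d with w-cases d
  ... | inj₁ w≡ rewrite w≡ = + 0 , + d , refl , law (ℕ→ℚ d)
    where
    law : ∀ D → 0ℚ * 0ℚ + D * (1ℚ * 1ℚ) ≡ D
    law = solve-∀ ℚ-ring
  ... | inj₂ (w≡ , e , refl) rewrite w≡ = + 1 , + (e ℕ.+ 1) , refl , (begin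
    ½ * ½ + ℕ→ℚ (3 ℕ.+ e ℕ.* 4) * (½ * ½)             ≡⟨ cong (λ D → ½ * ½ + D * (½ * ½)) (trans (ℕ→ℚ-+ 3 (e ℕ.* 4)) (cong (ℕ→ℚ 3 ℚ.+_) (ℕ→ℚ-* e 4))) ⟩
    ½ * ½ + (ℕ→ℚ 3 + ℕ→ℚ e * ℕ→ℚ 4) * (½ * ½)        ≡⟨ law (ℕ→ℚ e) ⟩
    ℕ→ℚ e + 1ℚ                                        ≡⟨ ℕ→ℚ-+ e 1 ⟨
    ℕ→ℚ (e ℕ.+ 1)                                     ∎)
    where
    open ≡-Reasoning
    law : ∀ E → ½ * ½ + (ℕ→ℚ 3 + E * ℕ→ℚ 4) * (½ * ½) ≡ E + 1ℚ
    law = solve-∀ ℚ-ring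

  InOK-+ : ∀ d {z z′} → InOK d z → InOK d z′ → InOK d (z +K z′)
  InOK-+ d (a , b , refl) (a′ , b′ , refl) = a ℤ.+ a′ , b ℤ.+ b′ ,
    trans (fromCoords-+ d (ℤ→ℚ a) (ℤ→ℚ b) (ℤ→ℚ a′) (ℤ→ℚ b′))
          (sym (cong₂ (fromCoords d) (ℤ→ℚ-+ a a′) (ℤ→ℚ-+ b b′)))

  InOK-- : ∀ d {z z′} → InOK d z → InOK d z′ → InOK d (z -K z′)
  InOK-- d (a , b , refl) (a′ , b′ , refl) = a ℤ.- a′ , b ℤ.- b′ ,
    trans (fromCoords-- d (ℤ→ℚ a) (ℤ→ℚ b) (ℤ→ℚ a′) (ℤ→ℚ b′))
          (sym (cong₂ (fromCoords d) (ℤ→ℚ-- a a′) (ℤ→ℚ-- b b′)))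

  InOK-·K : ∀ d {z} i → InOK d z → InOK d (ℤ→ℚ i ·K z)
  InOK-·K d i (a , b , refl) = i ℤ.* a , i ℤ.* b ,
    trans (·K-fromCoords d (ℤ→ℚ i) (ℤ→ℚ a) (ℤ→ℚ b))
          (sym (cong₂ (fromCoords d) (ℤ→ℚ-* i a) (ℤ→ℚ-* i b)))

  N-InOK : ∀ d {z} → InOK d z → ∃[ k ] N d z ≡ ℤ→ℚ k
  N-InOK d (a , b , refl) with w-integral d
  ... | s , n , s≡ , n≡ = a ℤ.* a ℤ.+ s ℤ.* (a ℤ.* b) ℤ.+ n ℤ.* (b ℤ.* b) , (begin
    N d (fromCoords d A B)                                              ≡⟨ N-fromCoords d A B ⟩
    A * A + (proj₁ (w d) + proj₁ (w d)) * (A * B) + N d (w d) * (B * B) ≡⟨ cong₂ (λ S M → A * A + S * (A * B) + M * (B * B)) s≡ n≡ ⟩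
    A * A + ℤ→ℚ s * (A * B) + ℤ→ℚ n * (B * B)                          ≡⟨ hom ⟨
    ℤ→ℚ (a ℤ.* a ℤ.+ s ℤ.* (a ℤ.* b) ℤ.+ n ℤ.* (b ℤ.* b))              ∎)
    where
    open ≡-Reasoning
    A = ℤ→ℚ a
    B = ℤ→ℚ b
    hom : ℤ→ℚ (a ℤ.* a ℤ.+ s ℤ.* (a ℤ.* b) ℤ.+ n ℤ.* (b ℤ.* b)) ≡ A * A + ℤ→ℚ s * (A * B) + ℤ→ℚ n * (B * B)
    hom = trans (ℤ→ℚ-+ (a ℤ.* a ℤ.+ s ℤ.* (a ℤ.* b)) (n ℤ.* (b ℤ.* b))) (cong₂ _+_
            (trans (ℤ→ℚ-+ (a ℤ.* a) (s ℤ.* (a ℤ.* b))) (cong₂ _+_ (ℤ→ℚ-* a a)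
              (trans (ℤ→ℚ-* s (a ℤ.* b)) (cong (ℤ→ℚ s *_) (ℤ→ℚ-* a b)))))
            (trans (ℤ→ℚ-* n (b ℤ.* b)) (cong (ℤ→ℚ n *_) (ℤ→ℚ-* b b))))

  InOS-intro : ∀ d {S c α} → InT S c → InOK d (ℕ→ℚ c ·K α) → InOS d S α
  InOS-intro d {c = c} c∈T (a , b , cα≡) = a , b , c , c∈T , cα≡

  InOS-+ : ∀ d {S α β} → InOS d S α → InOS d S β → InOS d S (α +K β)
  InOS-+ d {α = α} {β} (a , b , c , c∈T , cα≡) (a′ , b′ , c′ , c′∈T , c′β≡) =
    InOS-intro d (InT-* c∈T c′∈T) (subst (InOK d) (sym scaled)
      (InOK-+ d (InOK-·K d (+ c′) (a , b , cα≡)) (InOK-·K d (+ c) (a′ , b′ , c′β≡))))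
    where
    scaled : ℕ→ℚ (c ℕ.* c′) ·K (α +K β) ≡ (ℕ→ℚ c′ ·K (ℕ→ℚ c ·K α)) +K (ℕ→ℚ c ·K (ℕ→ℚ c′ ·K β))
    scaled = trans (cong (_·K (α +K β)) (ℕ→ℚ-* c c′)) (*-·K-+K (ℕ→ℚ c) (ℕ→ℚ c′) α β)

module Reduction where

  open PrimeStripping
  open RationalArithmetic
  open QuadraticField
  open import Data.Nat as ℕ using (ℕ; NonZero)
  import Data.Nat.Properties as ℕ
  open import Data.Nat.Coprimality using (Coprime; coprime-Bézout)
  open import Data.Nat.GCD using (module Bézout)
  open import Data.Nat.Primality using (Prime)
  open import Data.Integer as ℤ using (+_; 1ℤ)
  open import Data.Integer.DivMod using (_%ℕ_; _/ℕ_; a≡a%ℕn+[a/ℕn]*n; n%ℕd<d)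
  import Data.Integer.Properties as ℤ
  import Data.Integer.Tactic.RingSolver as ℤ-Solver
  open import Data.Rational as ℚ using (mkℚ; _+_; _*_; _-_; _<_; 0ℚ; 1ℚ; _/_; ↥_; ↧_; ↧ₙ_)
  import Data.Rational.Properties as ℚ
  open import Data.List.Relation.Unary.All using (All)
  open import Data.Product using (∃-syntax; _×_; _,_)
  open import Data.Sum using (inj₁; inj₂)
  open import Relation.Binary.PropositionalEquality
  open import Tactic.RingSolver using (solve-∀)

  ℕ-identity⇒ℤ : ∀ x y m n → 1 ℕ.+ y ℕ.* n ≡ x ℕ.* m → (ℤ.- + y) ℤ.* + n ℤ.+ + x ℤ.* + m ≡ 1ℤ
  ℕ-identity⇒ℤ x y m n 1+yn≡xm = begin
    (ℤ.- + y) ℤ.* + n ℤ.+ + x ℤ.* + m             ≡⟨ cong (λ k → (ℤ.- + y) ℤ.* + n ℤ.+ k) xm≡ ⟨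
    (ℤ.- + y) ℤ.* + n ℤ.+ (1ℤ ℤ.+ + y ℤ.* + n)    ≡⟨ cancel (+ y) (+ n) ⟩
    1ℤ                                           ∎
    where
    open ≡-Reasoning
    xm≡ : 1ℤ ℤ.+ + y ℤ.* + n ≡ + x ℤ.* + m
    xm≡ = trans (cong (λ k → 1ℤ ℤ.+ k) (sym (ℤ.pos-* y n)))
            (trans (sym (ℤ.pos-+ 1 (y ℕ.* n))) (trans (cong +_ 1+yn≡xm) (ℤ.pos-* x m)))
    cancel : ∀ y n → (ℤ.- y) ℤ.* n ℤ.+ (1ℤ ℤ.+ y ℤ.* n) ≡ 1ℤ
    cancel = ℤ-Solver.solve-∀

  coprime⇒ℤ-Bézout : ∀ {t r} → Coprime t r → ∃[ u ] ∃[ v ] u ℤ.* + r ℤ.+ v ℤ.* + t ≡ 1ℤ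
  coprime⇒ℤ-Bézout {t} {r} t⊥r with coprime-Bézout t⊥r
  ... | Bézout.+- x y 1+yr≡xt = ℤ.- + y , + x , ℕ-identity⇒ℤ x y t r 1+yr≡xt
  ... | Bézout.-+ x y 1+xt≡yr = + y , ℤ.- + x ,
    trans (ℤ.+-comm (+ y ℤ.* + r) _) (ℕ-identity⇒ℤ y x r t 1+xt≡yr)

  coprime-split : ∀ {t r} .{{_ : NonZero r}} → Coprime t r → ∀ a →
                  ∃[ a′ ] ∃[ g ] a′ ℕ.< r × a ≡ + r ℤ.* g ℤ.+ + t ℤ.* + a′
  coprime-split {t} {r} t⊥r a with coprime⇒ℤ-Bézout t⊥r
  ... | u , v , ur+vt≡1 = a′ , u ℤ.* a ℤ.+ + t ℤ.* q , n%ℕd<d (v ℤ.* a) r , (begin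
    a                                               ≡⟨ ℤ.*-identityʳ a ⟨
    a ℤ.* 1ℤ                                        ≡⟨ cong (a ℤ.*_) ur+vt≡1 ⟨
    a ℤ.* (u ℤ.* + r ℤ.+ v ℤ.* + t)                 ≡⟨ expand a u v (+ r) (+ t) ⟩
    + r ℤ.* (u ℤ.* a) ℤ.+ + t ℤ.* (v ℤ.* a)         ≡⟨ cong (λ k → + r ℤ.* (u ℤ.* a) ℤ.+ + t ℤ.* k) (a≡a%ℕn+[a/ℕn]*n (v ℤ.* a) r) ⟩
    + r ℤ.* (u ℤ.* a) ℤ.+ + t ℤ.* (+ a′ ℤ.+ q ℤ.* + r) ≡⟨ regroup (+ r) (+ t) (u ℤ.* a) q (+ a′) ⟩
    + r ℤ.* (u ℤ.* a ℤ.+ + t ℤ.* q) ℤ.+ + t ℤ.* + a′ ∎)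
    where
    open ≡-Reasoning
    a′ = (v ℤ.* a) %ℕ r
    q  = (v ℤ.* a) /ℕ r
    expand : ∀ a u v r t → a ℤ.* (u ℤ.* r ℤ.+ v ℤ.* t) ≡ r ℤ.* (u ℤ.* a) ℤ.+ t ℤ.* (v ℤ.* a)
    expand = ℤ-Solver.solve-∀
    regroup : ∀ r t b q a′ → r ℤ.* b ℤ.+ t ℤ.* (a′ ℤ.+ q ℤ.* r) ≡ r ℤ.* (b ℤ.+ t ℤ.* q) ℤ.+ t ℤ.* a′
    regroup = ℤ-Solver.solve-∀

  -- Partial fractions: x = a/(t r) = g/t + a′/r.
  fraction-split : ∀ t r .{{_ : NonZero r}} x a a′ g → ℕ→ℚ (t ℕ.* r) * x ≡ ℤ→ℚ a →
                   a ≡ + r ℤ.* g ℤ.+ + t ℤ.* + a′ → ℕ→ℚ t * (x - + a′ / r) ≡ ℤ→ℚ g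
  fraction-split t r x a a′ g trx≡a a≡ = *-cancelˡ-ℕ→ℚ r (begin
    ℕ→ℚ r * (ℕ→ℚ t * (x - + a′ / r))                         ≡⟨ expand (ℕ→ℚ r) (ℕ→ℚ t) x (+ a′ / r) ⟩
    (ℕ→ℚ t * ℕ→ℚ r) * x - ℕ→ℚ t * (ℕ→ℚ r * (+ a′ / r))     ≡⟨ cong₂ (λ p q → p * x - ℕ→ℚ t * q) (sym (ℕ→ℚ-* t r)) (n*[i/n]≡i (+ a′) r) ⟩
    ℕ→ℚ (t ℕ.* r) * x - ℕ→ℚ t * ℕ→ℚ a′                       ≡⟨ cong (_- ℕ→ℚ t * ℕ→ℚ a′) (trans trx≡a (cong ℤ→ℚ a≡)) ⟩
    ℤ→ℚ (+ r ℤ.* g ℤ.+ + t ℤ.* + a′) - ℕ→ℚ t * ℕ→ℚ a′        ≡⟨ cong (_- ℕ→ℚ t * ℕ→ℚ a′) hom ⟩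
    (ℕ→ℚ r * ℤ→ℚ g + ℕ→ℚ t * ℕ→ℚ a′) - ℕ→ℚ t * ℕ→ℚ a′       ≡⟨ cancel (ℕ→ℚ r * ℤ→ℚ g) (ℕ→ℚ t * ℕ→ℚ a′) ⟩
    ℕ→ℚ r * ℤ→ℚ g                                             ∎)
    where
    open ≡-Reasoning
    hom : ℤ→ℚ (+ r ℤ.* g ℤ.+ + t ℤ.* + a′) ≡ ℕ→ℚ r * ℤ→ℚ g + ℕ→ℚ t * ℕ→ℚ a′
    hom = trans (ℤ→ℚ-+ (+ r ℤ.* g) (+ t ℤ.* + a′)) (cong₂ _+_ (ℤ→ℚ-* (+ r) g) (ℤ→ℚ-* (+ t) (+ a′)))
    expand : ∀ R T x z → R * (T * (x - z)) ≡ (T * R) * x - T * (R * z)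
    expand = solve-∀ ℚ-ring
    cancel : ∀ p q → (p + q) - q ≡ p
    cancel = solve-∀ ℚ-ring

  split-coordinate : ∀ {t r} .{{_ : NonZero r}} → Coprime t r → ∀ x a → ℕ→ℚ (t ℕ.* r) * x ≡ ℤ→ℚ a →
                     ∃[ a′ ] ∃[ g ] a′ ℕ.< r × ℕ→ℚ t * (x - + a′ / r) ≡ ℤ→ℚ g
  split-coordinate {t} {r} t⊥r x a trx≡a =
    let a′ , g , a′<r , a≡ = coprime-split t⊥r a
    in  a′ , g , a′<r , fraction-split t r x a a′ g trx≡a a≡

  fromCoords-surjective : ∀ d ξ → ∃[ x ] ∃[ y ] ξ ≡ fromCoords d x y
  fromCoords-surjective d (x , y) with w-cases d
  ... | inj₁ w≡ = x , y , trans (cong₂ _,_ (law₁ x y) (law₂ y)) (cong (λ ω → ι x +K (y ·K ω)) (sym w≡))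
    where
    law₁ : ∀ x y → x ≡ x + y * 0ℚ
    law₁ = solve-∀ ℚ-ring
    law₂ : ∀ y → y ≡ 0ℚ + y * 1ℚ
    law₂ = solve-∀ ℚ-ring
  ... | inj₂ (w≡ , _) = x - y , y + y ,
    trans (cong₂ _,_ (law₁ x y) (law₂ y)) (cong (λ ω → ι (x - y) +K ((y + y) ·K ω)) (sym w≡))
    where
    law₁ : ∀ x y → x ≡ (x - y) + (y + y) * ℚ.½
    law₁ = solve-∀ ℚ-ring
    law₂ : ∀ y → y ≡ 0ℚ + (y + y) * ℚ.½
    law₂ = solve-∀ ℚ-ring

  denominator-clears : ∀ x n → ℕ→ℚ (↧ₙ x ℕ.* n) * x ≡ ℤ→ℚ (↥ x ℤ.* + n)
  denominator-clears x@(mkℚ _ _ _) n = begin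
    ℕ→ℚ (↧ₙ x ℕ.* n) * x           ≡⟨ cong (_* x) (ℕ→ℚ-* (↧ₙ x) n) ⟩
    (ℕ→ℚ (↧ₙ x) * ℕ→ℚ n) * x       ≡⟨ swap (ℕ→ℚ (↧ₙ x)) (ℕ→ℚ n) x ⟩
    (ℕ→ℚ (↧ₙ x) * x) * ℕ→ℚ n       ≡⟨ cong (λ p → ℕ→ℚ (↧ₙ x) * p * ℕ→ℚ n) (ℚ.↥p/↧p≡p x) ⟨
    (ℕ→ℚ (↧ₙ x) * (↥ x / ↧ₙ x)) * ℕ→ℚ n ≡⟨ cong (_* ℕ→ℚ n) (n*[i/n]≡i (↥ x) (↧ₙ x)) ⟩
    ℤ→ℚ (↥ x) * ℕ→ℚ n              ≡⟨ ℤ→ℚ-* (↥ x) (+ n) ⟨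
    ℤ→ℚ (↥ x ℤ.* + n)              ∎
    where
    open ≡-Reasoning
    swap : ∀ p q x → (p * q) * x ≡ (p * x) * q
    swap = solve-∀ ℚ-ring

  common-denominator : ∀ x y → ∃[ m ] NonZero m × ∃[ a ] ∃[ b ] ℕ→ℚ m * x ≡ ℤ→ℚ a × ℕ→ℚ m * y ≡ ℤ→ℚ b
  common-denominator x@(mkℚ _ _ _) y@(mkℚ _ _ _) =
    ↧ₙ x ℕ.* ↧ₙ y , _ , ↥ x ℤ.* ↧ y , ↥ y ℤ.* ↧ x ,
    denominator-clears x (↧ₙ y) ,
    trans (cong (λ m → ℕ→ℚ m * y) (ℕ.*-comm (↧ₙ x) (↧ₙ y))) (denominator-clears y (↧ₙ x))

  S-split-denominator : ∀ {S} → All Prime S → ∀ x y →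
    ∃[ t ] ∃[ r ] InT S t × NonZero r × PrimeTo S r ×
    ∃[ a ] ∃[ b ] ℕ→ℚ (t ℕ.* r) * x ≡ ℤ→ℚ a × ℕ→ℚ (t ℕ.* r) * y ≡ ℤ→ℚ b
  S-split-denominator {S} ps x y with common-denominator x y
  ... | m , m≢0 , a , b , mx≡a , my≡b with stripS-cofactor ps m {{m≢0}}
  ... | t , t∈T , m≡tr =
    t , stripS S m , t∈T , stripS-≢0 ps m {{m≢0}} , stripS-primeTo ps m {{m≢0}} , a , b ,
    subst (λ n → ℕ→ℚ n * x ≡ ℤ→ℚ a) m≡tr mx≡a , subst (λ n → ℕ→ℚ n * y ≡ ℤ→ℚ b) m≡tr my≡b

  fraction-point-∈F : ∀ d {a b r} .{{_ : NonZero r}} → a ℕ.< r → b ℕ.< r →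
                      InF d (fromCoords d (+ a / r) (+ b / r))
  fraction-point-∈F d {a} {b} {r} a<r b<r =
    + a / r , + b / r , 0≤a/n a r , a<n⇒a/n≤1 a<r , 0≤a/n b r , a<n⇒a/n≤1 b<r , refl

  fraction-point-scaled-∈OK : ∀ d a b r .{{_ : NonZero r}} → InOK d (ℕ→ℚ r ·K fromCoords d (+ a / r) (+ b / r))
  fraction-point-scaled-∈OK d a b r = + a , + b ,
    trans (·K-fromCoords d (ℕ→ℚ r) (+ a / r) (+ b / r)) (cong₂ (fromCoords d) (n*[i/n]≡i (+ a) r) (n*[i/n]≡i (+ b) r))

  split-point : ∀ {S t r} .{{_ : NonZero r}} → InT S t → PrimeTo S r → ∀ d x y a b →
                ℕ→ℚ (t ℕ.* r) * x ≡ ℤ→ℚ a → ℕ→ℚ (t ℕ.* r) * y ≡ ℤ→ℚ b →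
                ∃[ η ] InF d η × InOK d (ℕ→ℚ r ·K η) × InOS d S (fromCoords d x y -K η)
  split-point {t = t} {r} t∈T r-prime d x y a b trx≡a try≡b =
    let t⊥r = InT⇒coprime t∈T r-prime
        a′ , g , a′<r , tx≡g = split-coordinate t⊥r x a trx≡a
        b′ , h , b′<r , ty≡h = split-coordinate t⊥r y b try≡b
    in  fromCoords d (+ a′ / r) (+ b′ / r) , fraction-point-∈F d a′<r b′<r ,
        fraction-point-scaled-∈OK d a′ b′ r ,
        InOS-intro d t∈T (g , h , trans (·K-fromCoords-- d (ℕ→ℚ t) x y (+ a′ / r) (+ b′ / r))
                                          (cong₂ (fromCoords d) tx≡g ty≡h))

  reduce-into-F : ∀ {S} → All Prime S → ∀ d ξ →
    ∃[ η ] ∃[ r ] InF d η × NonZero r × PrimeTo S r × InOK d (ℕ→ℚ r ·K η) × InOS d S (ξ -K η)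
  reduce-into-F {S} ps d ξ =
    let x , y , ξ≡ = fromCoords-surjective d ξ
        t , r , t∈T , r≢0 , r-prime , a , b , trx≡a , try≡b = S-split-denominator ps x y
        η , η∈F , rη∈OK , ξ-η∈OS = split-point {{r≢0}} t∈T r-prime d x y a b trx≡a try≡b
    in  η , r , η∈F , r≢0 , r-prime , rη∈OK , subst (λ ξ → InOS d S (ξ -K η)) (sym ξ≡) ξ-η∈OS

  NS-norm<1 : ∀ {S} → All Prime S → ∀ d {η α r c} → PrimeTo S r → .{{_ : NonZero r}} → InOK d (ℕ→ℚ r ·K η) →
            InT S c → InOK d (ℕ→ℚ c ·K α) → N d (η -K α) * (ℕ→ℚ c * ℕ→ℚ c) < 1ℚ →
            NS S (N d (η -K α)) < 1ℚ
  NS-norm<1 ps d {η} {α} {r} {c} r-prime rη∈OK c∈T cα∈OK small =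
    let k , N-scaled≡k = N-InOK d scaled∈OK
    in  integral-multiple⇒NS<1 ps (InT-* c∈T c∈T) (primeTo-* ps r-prime r-prime) {{ℕ.m*n≢0 r r}} (N d (η -K α)) k
          (N-nonNeg d (η -K α)) (N-times-square≡k k N-scaled≡k)
          (subst (λ C → N d (η -K α) * C < 1ℚ) (sym (ℕ→ℚ-* c c)) small)
    where
    s = r ℕ.* c
    scaled∈OK : InOK d (ℕ→ℚ s ·K (η -K α))
    scaled∈OK = subst (InOK d) (sym (trans (cong (_·K (η -K α)) (ℕ→ℚ-* r c)) (*-·K--K (ℕ→ℚ r) (ℕ→ℚ c) η α)))
      (InOK-- d (InOK-·K d (+ c) rη∈OK) (InOK-·K d (+ r) cα∈OK))
    N-times-square≡k : ∀ k → N d (ℕ→ℚ s ·K (η -K α)) ≡ ℤ→ℚ k →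
                       N d (η -K α) * ℕ→ℚ ((c ℕ.* c) ℕ.* (r ℕ.* r)) ≡ ℤ→ℚ k
    N-times-square≡k k N-scaled≡k = begin
      N d (η -K α) * ℕ→ℚ ((c ℕ.* c) ℕ.* (r ℕ.* r)) ≡⟨ cong (λ m → N d (η -K α) * ℕ→ℚ m) cc·rr≡s·s ⟩
      N d (η -K α) * ℕ→ℚ (s ℕ.* s)                 ≡⟨ cong (N d (η -K α) *_) (ℕ→ℚ-* s s) ⟩
      N d (η -K α) * (ℕ→ℚ s * ℕ→ℚ s)               ≡⟨ ℚ.*-comm (N d (η -K α)) _ ⟩
      (ℕ→ℚ s * ℕ→ℚ s) * N d (η -K α)               ≡⟨ N-·K d (ℕ→ℚ s) (η -K α) ⟨
      N d (ℕ→ℚ s ·K (η -K α))                       ≡⟨ N-scaled≡k ⟩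
      ℤ→ℚ k                                         ∎
      where
      open ≡-Reasoning
      cc·rr≡s·s : (c ℕ.* c) ℕ.* (r ℕ.* r) ≡ s ℕ.* s
      cc·rr≡s·s = trans (ℕ.*-comm (c ℕ.* c) (r ℕ.* r)) (sym (ℕ.[m*n]*[o*p]≡[m*o]*[n*p] r c r c))

open import Data.Nat using (ℕ; _<_)
open import Data.Nat.Primality using (Prime)
open import Data.List using (List)
open import Data.List.Relation.Unary.All using (All)
open import Data.Product using (_×_; ∃-syntax; _,_)
open import Data.Rational as ℚ using (1ℚ)
open import Relation.Binary.PropositionalEquality using (sym; subst)
open QuadraticField using (InOS-+; -K-+K-cancel)
open Reduction using (reduce-into-F; NS-norm<1)

lemma2 : (d : ℕ) → 0 < d → Squarefree d →
         (S : List ℕ) → All Prime S →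
         (∀ ξ → InF d ξ →
            ∃[ α ] ∃[ c ] (IsDenom d S α c ×
               (N d (ξ -K α) ℚ.* (ℕ→ℚ c ℚ.* ℕ→ℚ c) ℚ.< 1ℚ))) →
         SNormEuclidean d S
lemma2 d _ _ S ps hyp ξ =
  let η , r , η∈F , r≢0 , r-prime , rη∈OK , ξ-η∈OS = reduce-into-F ps d ξ
      α , c , ((a , b , c∈T , cα≡) , _) , small = hyp η η∈F
  in  (ξ -K η) +K α , InOS-+ d ξ-η∈OS (a , b , c , c∈T , cα≡) ,
      subst (λ z → NS S (N d z) ℚ.< 1ℚ) (sym (-K-+K-cancel ξ η α))
            (NS-norm<1 ps d r-prime {{r≢0}} rη∈OK c∈T (a , b , cα≡) small)
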